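{- Let $G$ be a graph, let $f$ be an $(8:3)$-coloring of $G$, and let $u,v$ be two distinct vertices of $G$. Let $H$ be the graph obtained from $G$ by adding a new vertex $x$ and edges $ux,vx$, and let $H'$ be the graph obtained from $G$ by adding two new vertices $y,z$ and edges $uy,yz,zv$. If $f(u)\cap f(v)\neq\emptyset$, then $f$ can be extended to an $(8:3)$-coloring of $H$. If $f(u)\neq f(v)$, then $f$ can be extended to an $(8:3)$-coloring of $H'$.
   Context: An $(8:3)$-coloring assigns to each vertex a $3$-subset of $\{1,\dots,8\}$ so that adjacent vertices receive disjoint sets. Extending $f$ means the new coloring agrees with $f$ on $V(G)$. -}

module Defs where

open import Data.Nat using (ℕ)
open import Data.Fin.Subset using (Subset; _∩_; ∣_∣; Empty)
open import Data.Sum using (_⊎_; inj₁; inj₂)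
open import Data.Unit using (⊤; tt)
open import Data.Empty using (⊥)
open import Data.Product using (Σ; _×_; _,_)
open import Relation.Nullary using (¬_)
open import Relation.Binary.PropositionalEquality using (_≡_; refl)

record Graph : Set₁ where
  field
    V      : Set
    Adj    : V → V → Set
    sym    : ∀ {a b} → Adj a b → Adj b a
    irrefl : ∀ {a} → ¬ Adj a a
open Graph public

-- Colours are the elements of {1,…,8}, represented by Fin 8;
-- a colour set is a subset of Fin 8.
Colour-set : Set
Colour-set = Subset 8

Is83Coloring : (G : Graph) → (V G → Colour-set) → Set
Is83Coloring G f =
  (∀ a → ∣ f a ∣ ≡ 3) × (∀ a b → Adj G a b → Empty (f a ∩ f b))

-- H : add one new vertex x adjacent to u and v.
-- Vertices: inj₁ a for a ∈ V(G), inj₂ tt for x.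
H-Adj : (G : Graph) (u v : V G) → V G ⊎ ⊤ → V G ⊎ ⊤ → Set
H-Adj G u v (inj₁ a) (inj₁ b) = Adj G a b
H-Adj G u v (inj₁ a) (inj₂ _) = (a ≡ u) ⊎ (a ≡ v)
H-Adj G u v (inj₂ _) (inj₁ b) = (b ≡ u) ⊎ (b ≡ v)
H-Adj G u v (inj₂ _) (inj₂ _) = ⊥

H-sym : (G : Graph) (u v : V G) → ∀ {a b} → H-Adj G u v a b → H-Adj G u v b a
H-sym G u v {inj₁ a} {inj₁ b} e = sym G e
H-sym G u v {inj₁ a} {inj₂ _} e = e
H-sym G u v {inj₂ _} {inj₁ b} e = e

H-irrefl : (G : Graph) (u v : V G) → ∀ {a} → ¬ H-Adj G u v a a
H-irrefl G u v {inj₁ a} e = irrefl G e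
H-irrefl G u v {inj₂ _} ()

addCommonNeighbour : (G : Graph) (u v : V G) → Graph
addCommonNeighbour G u v = record
  { V = V G ⊎ ⊤ ; Adj = H-Adj G u v ; sym = λ {a} {b} → H-sym G u v {a} {b} ; irrefl = λ {a} → H-irrefl G u v {a} }

data YZ : Set where
  y z : YZ

H'-Adj : (G : Graph) (u v : V G) → V G ⊎ YZ → V G ⊎ YZ → Set
H'-Adj G u v (inj₁ a) (inj₁ b) = Adj G a b
H'-Adj G u v (inj₁ a) (inj₂ y) = a ≡ u
H'-Adj G u v (inj₁ a) (inj₂ z) = a ≡ v
H'-Adj G u v (inj₂ y) (inj₁ b) = b ≡ u
H'-Adj G u v (inj₂ z) (inj₁ b) = b ≡ v
H'-Adj G u v (inj₂ y) (inj₂ y) = ⊥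
H'-Adj G u v (inj₂ y) (inj₂ z) = ⊤
H'-Adj G u v (inj₂ z) (inj₂ y) = ⊤
H'-Adj G u v (inj₂ z) (inj₂ z) = ⊥

H'-sym : (G : Graph) (u v : V G) → ∀ {a b} → H'-Adj G u v a b → H'-Adj G u v b a
H'-sym G u v {inj₁ a} {inj₁ b} e = sym G e
H'-sym G u v {inj₁ a} {inj₂ y} e = e
H'-sym G u v {inj₁ a} {inj₂ z} e = e
H'-sym G u v {inj₂ y} {inj₁ b} e = e
H'-sym G u v {inj₂ z} {inj₁ b} e = e
H'-sym G u v {inj₂ y} {inj₂ z} e = tt
H'-sym G u v {inj₂ z} {inj₂ y} e = tt

H'-irrefl : (G : Graph) (u v : V G) → ∀ {a} → ¬ H'-Adj G u v a a
H'-irrefl G u v {inj₁ a} e = irrefl G e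
H'-irrefl G u v {inj₂ y} ()
H'-irrefl G u v {inj₂ z} ()

addPath3 : (G : Graph) (u v : V G) → Graph
addPath3 G u v = record
  { V = V G ⊎ YZ ; Adj = H'-Adj G u v ; sym = λ {a} {b} → H'-sym G u v {a} {b} ; irrefl = λ {a} → H'-irrefl G u v {a} }

Extends : (G : Graph) {W : Set} → (V G ⊎ W → Colour-set) → (V G → Colour-set) → Set
Extends G g f = ∀ a → g (inj₁ a) ≡ f a

module Submission where

-- Proof idea.  Everything reduces to facts about 3-subsets of the colour set
-- {1,…,8}; the graph part is then a case check over the new edges.
--
-- Counting (inclusion–exclusion): two 3-sets A, B of colours leave exactly
-- 8 - |A ∪ B| = 2 + |A ∩ B| colours unused.
--  * H: if f u and f v share a colour, at least 3 colours are unused, and any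
--    3 of them colour the common neighbour x.
--  * H': if f u ≠ f v, some colour b of f v is missing from f u; together with
--    two colours unused by both it forms a 3-set Y disjoint from f u that
--    shares b with f v.  The first construction applied to f v and Y gives Z,
--    and the path u – y – z – v is coloured by Y, Z.

open import Defs
open import Data.Fin.Subset using (_∩_; Empty)
open import Data.Product using (Σ; _×_)
open import Relation.Nullary using (¬_)
open import Relation.Binary.PropositionalEquality using (_≡_)

open import Data.Nat using (zero; suc; _+_; _≤_; _<_; z≤n; s≤s)
open import Data.Nat.Properties
  using (+-suc; +-assoc; +-comm; +-identityʳ; +-cancelʳ-≡; m∸n+n≡m; n≢0⇒n>0; <⇒≱; ≤-reflexive; +-monoʳ-≤)
open import Data.Fin.Subset using (Subset; _∪_; ∁; ∣_∣; _∈_; _∉_; _⊆_; _-_; ⊥; ⁅_⁆; Nonempty; inside; outside)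
open import Data.Fin.Subset.Properties
open import Data.Vec using ([]; _∷_)
open import Data.Vec.Base using (here)
open import Data.Product using (_,_)
open import Data.Sum using (_⊎_; inj₁; inj₂; [_,_])
open import Data.Unit using (⊤)
open import Data.Empty using (⊥-elim)
open import Relation.Nullary using (yes; no)
open import Relation.Binary.PropositionalEquality
  using (refl; trans; cong; cong₂; subst; module ≡-Reasoning)
  renaming (sym to ≡-sym)

Disjoint : ∀ {n} → Subset n → Subset n → Set
Disjoint p q = Empty (p ∩ q)

disjoint : ∀ {n} {p q : Subset n} → (∀ {x} → x ∈ p → x ∉ q) → Disjoint p q
disjoint {p = p} {q} apart (x , x∈p∩q) with x∈p∩q⁻ p q x∈p∩q
... | x∈p , x∈q = apart x∈p x∈q

disjoint-sym : ∀ {n} {p q : Subset n} → Disjoint p q → Disjoint q p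
disjoint-sym {p = p} {q} d = disjoint λ x∈q x∈p → d (_ , x∈p∩q⁺ (x∈p , x∈q))

⊆∁⇒disjoint : ∀ {n} {p q : Subset n} → p ⊆ ∁ q → Disjoint p q
⊆∁⇒disjoint p⊆∁q = disjoint λ x∈p → x∈∁p⇒x∉p (p⊆∁q x∈p)

∁∪⊆∁ˡ : ∀ {n} (p q : Subset n) → ∁ (p ∪ q) ⊆ ∁ p
∁∪⊆∁ˡ p q = p⊆q⇒∁p⊇∁q (p⊆p∪q q)

∁∪⊆∁ʳ : ∀ {n} (p q : Subset n) → ∁ (p ∪ q) ⊆ ∁ q
∁∪⊆∁ʳ p q = p⊆q⇒∁p⊇∁q (q⊆p∪q p q)

∣p∪q∣+∣p∩q∣ : ∀ {n} (p q : Subset n) → ∣ p ∪ q ∣ + ∣ p ∩ q ∣ ≡ ∣ p ∣ + ∣ q ∣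
∣p∪q∣+∣p∩q∣ [] [] = refl
∣p∪q∣+∣p∩q∣ (inside ∷ p) (inside ∷ q) =
  cong suc (trans (+-suc _ _) (trans (cong suc (∣p∪q∣+∣p∩q∣ p q)) (≡-sym (+-suc _ _))))
∣p∪q∣+∣p∩q∣ (inside ∷ p) (outside ∷ q) = cong suc (∣p∪q∣+∣p∩q∣ p q)
∣p∪q∣+∣p∩q∣ (outside ∷ p) (inside ∷ q) = trans (cong suc (∣p∪q∣+∣p∩q∣ p q)) (≡-sym (+-suc _ _))
∣p∪q∣+∣p∩q∣ (outside ∷ p) (outside ∷ q) = ∣p∪q∣+∣p∩q∣ p q

∣∁p∣+∣p∣ : ∀ {n} (p : Subset n) → ∣ ∁ p ∣ + ∣ p ∣ ≡ n
∣∁p∣+∣p∣ p = trans (cong (_+ ∣ p ∣) (∣∁p∣≡n∸∣p∣ p)) (m∸n+n≡m (∣p∣≤n p))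

∣∁[p∪q]∣ : ∀ {n} (p q : Subset n) → ∣ ∁ (p ∪ q) ∣ + (∣ p ∣ + ∣ q ∣) ≡ n + ∣ p ∩ q ∣
∣∁[p∪q]∣ {n} p q = begin
  ∣ ∁ (p ∪ q) ∣ + (∣ p ∣ + ∣ q ∣)            ≡⟨ cong (∣ ∁ (p ∪ q) ∣ +_) (≡-sym (∣p∪q∣+∣p∩q∣ p q)) ⟩
  ∣ ∁ (p ∪ q) ∣ + (∣ p ∪ q ∣ + ∣ p ∩ q ∣)    ≡⟨ ≡-sym (+-assoc ∣ ∁ (p ∪ q) ∣ _ _) ⟩
  ∣ ∁ (p ∪ q) ∣ + ∣ p ∪ q ∣ + ∣ p ∩ q ∣      ≡⟨ cong (_+ ∣ p ∩ q ∣) (∣∁p∣+∣p∣ (p ∪ q)) ⟩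
  n + ∣ p ∩ q ∣                              ∎
  where open ≡-Reasoning

Empty⇒∣p∣≡0 : ∀ {n} {p : Subset n} → Empty p → ∣ p ∣ ≡ 0
Empty⇒∣p∣≡0 {n} e = trans (cong ∣_∣ (Empty-unique e)) (∣⊥∣≡0 n)

∣p∣≡0⇒Empty : ∀ {n} {p : Subset n} → ∣ p ∣ ≡ 0 → Empty p
∣p∣≡0⇒Empty {p = p} ∣p∣≡0 (x , x∈p) =
  <⇒≱ (subst (∣ p - x ∣ <_) ∣p∣≡0 (x∈p⇒∣p-x∣<∣p∣ x∈p)) z≤n

¬Empty⇒1≤∣p∣ : ∀ {n} {p : Subset n} → ¬ Empty p → 1 ≤ ∣ p ∣
¬Empty⇒1≤∣p∣ nonempty = n≢0⇒n>0 λ ∣p∣≡0 → nonempty (∣p∣≡0⇒Empty ∣p∣≡0)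

choose : ∀ {n} k (p : Subset n) → k ≤ ∣ p ∣ → Σ (Subset n) λ X → X ⊆ p × ∣ X ∣ ≡ k
choose {n} zero p _ = ⊥ , ⊥⊆ {p = p} , ∣⊥∣≡0 n
choose (suc k) (inside ∷ p) (s≤s k≤∣p∣) with choose k p k≤∣p∣
... | X , X⊆p , ∣X∣≡k = inside ∷ X , s⊆s X⊆p , cong suc ∣X∣≡k
choose (suc k) (outside ∷ p) k<∣p∣ with choose (suc k) p k<∣p∣
... | X , X⊆p , ∣X∣≡k = outside ∷ X , s⊆s X⊆p , ∣X∣≡k

⊆-card-≡ : ∀ {n} {p q : Subset n} → p ⊆ q → ∣ q ∣ ≤ ∣ p ∣ → p ≡ q
⊆-card-≡ {p = []} {[]} _ _ = refl
⊆-card-≡ {p = inside ∷ p} {inside ∷ q} p⊆q (s≤s ∣q∣≤∣p∣) =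
  cong (inside ∷_) (⊆-card-≡ (drop-∷-⊆ p⊆q) ∣q∣≤∣p∣)
⊆-card-≡ {p = outside ∷ p} {outside ∷ q} p⊆q ∣q∣≤∣p∣ =
  cong (outside ∷_) (⊆-card-≡ (drop-∷-⊆ p⊆q) ∣q∣≤∣p∣)
⊆-card-≡ {p = outside ∷ p} {inside ∷ q} p⊆q ∣q∣<∣p∣ =
  ⊥-elim (<⇒≱ (s≤s (p⊆q⇒∣p∣≤∣q∣ (drop-∷-⊆ p⊆q))) ∣q∣<∣p∣)
⊆-card-≡ {p = inside ∷ p} {outside ∷ q} p⊆q _ with p⊆q here
... | ()

-- Of two distinct sets of the same size, the second has an element outside
-- the first (otherwise it would be a subset of the first of equal size).
freshElement : ∀ {n} (p q : Subset n) → ∣ p ∣ ≡ ∣ q ∣ → ¬ p ≡ q → Nonempty (q ∩ ∁ p)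
freshElement p q ∣p∣≡∣q∣ p≢q with nonempty? (q ∩ ∁ p)
... | yes fresh = fresh
... | no none = ⊥-elim (p≢q (≡-sym (⊆-card-≡ q⊆p (≤-reflexive ∣p∣≡∣q∣))))
  where
  q⊆p : q ⊆ p
  q⊆p x∈q = x∉∁p⇒x∈p λ x∈∁p → none (_ , x∈p∩q⁺ (x∈q , x∈∁p))

freeColours : (A B : Subset 8) → ∣ A ∣ ≡ 3 → ∣ B ∣ ≡ 3 → ∣ ∁ (A ∪ B) ∣ ≡ 2 + ∣ A ∩ B ∣
freeColours A B ∣A∣≡3 ∣B∣≡3 = +-cancelʳ-≡ 6 _ _ (begin
  ∣ ∁ (A ∪ B) ∣ + 6                  ≡⟨ cong (∣ ∁ (A ∪ B) ∣ +_) (≡-sym (cong₂ _+_ ∣A∣≡3 ∣B∣≡3)) ⟩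
  ∣ ∁ (A ∪ B) ∣ + (∣ A ∣ + ∣ B ∣)    ≡⟨ ∣∁[p∪q]∣ A B ⟩
  6 + (2 + ∣ A ∩ B ∣)                ≡⟨ +-comm 6 (2 + ∣ A ∩ B ∣) ⟩
  2 + ∣ A ∩ B ∣ + 6                  ∎)
  where open ≡-Reasoning

atLeastFree : (A B : Subset 8) → ∣ A ∣ ≡ 3 → ∣ B ∣ ≡ 3 →
              ∀ {k} → k ≤ ∣ A ∩ B ∣ → 2 + k ≤ ∣ ∁ (A ∪ B) ∣
atLeastFree A B ∣A∣≡3 ∣B∣≡3 k≤shared =
  subst (2 + _ ≤_) (≡-sym (freeColours A B ∣A∣≡3 ∣B∣≡3)) (+-monoʳ-≤ 2 k≤shared)

avoidBoth : (A B : Subset 8) → ∣ A ∣ ≡ 3 → ∣ B ∣ ≡ 3 → ¬ Empty (A ∩ B) →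
            Σ (Subset 8) λ X → ∣ X ∣ ≡ 3 × Disjoint X A × Disjoint X B
avoidBoth A B ∣A∣≡3 ∣B∣≡3 shared
  with choose 3 (∁ (A ∪ B)) (atLeastFree A B ∣A∣≡3 ∣B∣≡3 (¬Empty⇒1≤∣p∣ shared))
... | X , X⊆free , ∣X∣≡3 =
  X , ∣X∣≡3 , ⊆∁⇒disjoint (⊆-trans X⊆free (∁∪⊆∁ˡ A B))
            , ⊆∁⇒disjoint (⊆-trans X⊆free (∁∪⊆∁ʳ A B))

-- Colour for the neighbour of u on a path: given b ∈ B outside A, the set
-- {b} ∪ (two colours unused by A and B) is a 3-set disjoint from A that
-- shares b with B.
bridgeThrough : (A B : Subset 8) → ∣ A ∣ ≡ 3 → ∣ B ∣ ≡ 3 → ∀ b → b ∈ B → b ∉ A →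
                Σ (Subset 8) λ Y → ∣ Y ∣ ≡ 3 × Disjoint Y A × ¬ Disjoint B Y
bridgeThrough A B ∣A∣≡3 ∣B∣≡3 b b∈B b∉A
  with choose 2 (∁ (A ∪ B)) (atLeastFree A B ∣A∣≡3 ∣B∣≡3 z≤n)
... | P , P⊆free , ∣P∣≡2 = ⁅ b ⁆ ∪ P , ∣Y∣≡3 , ⊆∁⇒disjoint Y⊆∁A , b∈B∩Y
  where
  b∉P : Disjoint ⁅ b ⁆ P
  b∉P = disjoint λ {x} x∈⁅b⁆ x∈P →
    x∈∁p⇒x∉p (∁∪⊆∁ʳ A B (P⊆free x∈P)) (subst (_∈ B) (≡-sym (x∈⁅y⁆⇒x≡y b x∈⁅b⁆)) b∈B)

  ∣Y∣≡3 : ∣ ⁅ b ⁆ ∪ P ∣ ≡ 3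
  ∣Y∣≡3 = begin
    ∣ ⁅ b ⁆ ∪ P ∣                      ≡⟨ ≡-sym (+-identityʳ _) ⟩
    ∣ ⁅ b ⁆ ∪ P ∣ + 0                  ≡⟨ cong (∣ ⁅ b ⁆ ∪ P ∣ +_) (≡-sym (Empty⇒∣p∣≡0 b∉P)) ⟩
    ∣ ⁅ b ⁆ ∪ P ∣ + ∣ ⁅ b ⁆ ∩ P ∣      ≡⟨ ∣p∪q∣+∣p∩q∣ ⁅ b ⁆ P ⟩
    ∣ ⁅ b ⁆ ∣ + ∣ P ∣                  ≡⟨ cong₂ _+_ (∣⁅x⁆∣≡1 b) ∣P∣≡2 ⟩
    3                                  ∎
    where open ≡-Reasoning

  Y⊆∁A : ⁅ b ⁆ ∪ P ⊆ ∁ A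
  Y⊆∁A x∈Y = [ (λ x∈⁅b⁆ → subst (_∈ ∁ A) (≡-sym (x∈⁅y⁆⇒x≡y b x∈⁅b⁆)) (x∉p⇒x∈∁p b∉A))
             , (λ x∈P → ∁∪⊆∁ˡ A B (P⊆free x∈P)) ] (x∈p∪q⁻ ⁅ b ⁆ P x∈Y)

  b∈B∩Y : ¬ Disjoint B (⁅ b ⁆ ∪ P)
  b∈B∩Y d = d (b , x∈p∩q⁺ (b∈B , x∈p∪q⁺ (inj₁ (x∈⁅x⁆ b))))

bridge : (A B : Subset 8) → ∣ A ∣ ≡ 3 → ∣ B ∣ ≡ 3 → ¬ A ≡ B →
         Σ (Subset 8) λ Y → ∣ Y ∣ ≡ 3 × Disjoint Y A × ¬ Disjoint B Y
bridge A B ∣A∣≡3 ∣B∣≡3 A≢B =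
  let b , b∈B∖A = freshElement A B (trans ∣A∣≡3 (≡-sym ∣B∣≡3)) A≢B
      b∈B , b∈∁A = x∈p∩q⁻ B (∁ A) b∈B∖A
  in bridgeThrough A B ∣A∣≡3 ∣B∣≡3 b b∈B (x∈∁p⇒x∉p b∈∁A)

-- Colours for a path of length 3: if A ≠ B are 3-sets, there are 3-sets Y, Z
-- with A, Y, Z, B consecutively disjoint (Z avoids both B and the bridge Y).
pathColours : (A B : Subset 8) → ∣ A ∣ ≡ 3 → ∣ B ∣ ≡ 3 → ¬ A ≡ B →
              Σ (Subset 8) λ Y → Σ (Subset 8) λ Z →
                ∣ Y ∣ ≡ 3 × ∣ Z ∣ ≡ 3 × Disjoint Y A × Disjoint Y Z × Disjoint Z B
pathColours A B ∣A∣≡3 ∣B∣≡3 A≢B =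
  let Y , ∣Y∣≡3 , Y∩A , B∩Y = bridge A B ∣A∣≡3 ∣B∣≡3 A≢B
      Z , ∣Z∣≡3 , Z∩B , Z∩Y = avoidBoth B Y ∣B∣≡3 ∣Y∣≡3 B∩Y
  in Y , Z , ∣Y∣≡3 , ∣Z∣≡3 , Y∩A , disjoint-sym Z∩Y , Z∩B

extendToH : (G : Graph) (f : V G → Colour-set) → Is83Coloring G f → (u v : V G) →
            (X : Colour-set) → ∣ X ∣ ≡ 3 → Disjoint X (f u) → Disjoint X (f v) →
            Σ (V (addCommonNeighbour G u v) → Colour-set) λ g →
              Is83Coloring (addCommonNeighbour G u v) g × Extends G g f
extendToH G f (sized , proper) u v X ∣X∣≡3 X∩fu X∩fv = g , (g-sized , g-proper) , λ _ → refl
  where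
  g : V G ⊎ ⊤ → Colour-set
  g (inj₁ a) = f a
  g (inj₂ _) = X

  g-sized : ∀ a → ∣ g a ∣ ≡ 3
  g-sized (inj₁ a) = sized a
  g-sized (inj₂ _) = ∣X∣≡3

  g-proper : ∀ a b → H-Adj G u v a b → Disjoint (g a) (g b)
  g-proper (inj₁ a) (inj₁ b) a~b = proper a b a~b
  g-proper (inj₁ _) (inj₂ _) (inj₁ refl) = disjoint-sym X∩fu
  g-proper (inj₁ _) (inj₂ _) (inj₂ refl) = disjoint-sym X∩fv
  g-proper (inj₂ _) (inj₁ _) (inj₁ refl) = X∩fu
  g-proper (inj₂ _) (inj₁ _) (inj₂ refl) = X∩fv

extendToH' : (G : Graph) (f : V G → Colour-set) → Is83Coloring G f → (u v : V G) →
             (Y Z : Colour-set) → ∣ Y ∣ ≡ 3 → ∣ Z ∣ ≡ 3 →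
             Disjoint Y (f u) → Disjoint Y Z → Disjoint Z (f v) →
             Σ (V (addPath3 G u v) → Colour-set) λ g →
               Is83Coloring (addPath3 G u v) g × Extends G g f
extendToH' G f (sized , proper) u v Y Z ∣Y∣≡3 ∣Z∣≡3 Y∩fu Y∩Z Z∩fv =
  g , (g-sized , g-proper) , λ _ → refl
  where
  g : V G ⊎ YZ → Colour-set
  g (inj₁ a) = f a
  g (inj₂ y) = Y
  g (inj₂ z) = Z

  g-sized : ∀ a → ∣ g a ∣ ≡ 3
  g-sized (inj₁ a) = sized a
  g-sized (inj₂ y) = ∣Y∣≡3
  g-sized (inj₂ z) = ∣Z∣≡3

  g-proper : ∀ a b → H'-Adj G u v a b → Disjoint (g a) (g b)
  g-proper (inj₁ a) (inj₁ b) a~b = proper a b a~b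
  g-proper (inj₁ _) (inj₂ y) refl = disjoint-sym Y∩fu
  g-proper (inj₁ _) (inj₂ z) refl = disjoint-sym Z∩fv
  g-proper (inj₂ y) (inj₁ _) refl = Y∩fu
  g-proper (inj₂ z) (inj₁ _) refl = Z∩fv
  g-proper (inj₂ y) (inj₂ z) _ = Y∩Z
  g-proper (inj₂ z) (inj₂ y) _ = disjoint-sym Y∩Z

lemma9 : (G : Graph) (f : V G → Colour-set) → Is83Coloring G f →
         (u v : V G) → ¬ (u ≡ v) →
         ((¬ Empty (f u ∩ f v)) →
            Σ (V (addCommonNeighbour G u v) → Colour-set) λ g →
              Is83Coloring (addCommonNeighbour G u v) g × Extends G g f)
         × ((¬ (f u ≡ f v)) →
            Σ (V (addPath3 G u v) → Colour-set) λ g →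
              Is83Coloring (addPath3 G u v) g × Extends G g f)
lemma9 G f coloring@(sized , _) u v _ = toH , toH'
  where
  toH : ¬ Empty (f u ∩ f v) →
        Σ (V (addCommonNeighbour G u v) → Colour-set) λ g →
          Is83Coloring (addCommonNeighbour G u v) g × Extends G g f
  toH shared =
    let X , ∣X∣≡3 , X∩fu , X∩fv = avoidBoth (f u) (f v) (sized u) (sized v) shared
    in extendToH G f coloring u v X ∣X∣≡3 X∩fu X∩fv

  toH' : ¬ f u ≡ f v →
         Σ (V (addPath3 G u v) → Colour-set) λ g →
           Is83Coloring (addPath3 G u v) g × Extends G g f
  toH' fu≢fv =
    let Y , Z , ∣Y∣≡3 , ∣Z∣≡3 , Y∩fu , Y∩Z , Z∩fv = pathColours (f u) (f v) (sized u) (sized v) fu≢fv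
    in extendToH' G f coloring u v Y Z ∣Y∣≡3 ∣Z∣≡3 Y∩fu Y∩Z Z∩fv
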